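{- Let $n\geq 6$ be even. Then there exists an $\mathrm{SH}^*(n;6)$.
   Context: An $\mathrm{H}(n;k)$ is an $n\times n$ partially filled array with entries in $\{\pm1,\dots,\pm nk\}\subset\mathbb{Z}$ such that no two entries agree in absolute value, each row and each column has exactly $k$ filled cells, and every row and every column sums to $0$ in $\mathbb{Z}$. An ordering $(a_1,\dots,a_k)$ is simple modulo $v$ if its partial sums $s_i=\sum_{j\le i}a_j$ are pairwise distinct modulo $v$. An $\mathrm{SH}^*(n;k)$ is an $\mathrm{H}(n;k)$ in which the natural ordering of each row (left to right, skipping empty cells) and each column (top to bottom, skipping empty cells) is simple both modulo $2nk+1$ and modulo $2nk+2$. -}

module Defs where

open import Data.Nat as ℕ using (ℕ; suc; NonZero)
open import Data.Integer as ℤ using (ℤ; ∣_∣; +_)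
open import Data.Integer.DivMod using (_%ℕ_)
open import Data.Fin using (Fin)
open import Data.List using (List; []; _∷_; map; length; foldr; mapMaybe; allFin)
open import Data.List.Relation.Unary.Unique.Propositional using (Unique)
open import Data.Maybe using (Maybe; just; nothing)
open import Data.Product using (_×_)
open import Relation.Binary.PropositionalEquality using (_≡_; _≢_)
open import Function using (id)

sumℤ : List ℤ → ℤ
sumℤ = foldr ℤ._+_ (+ 0)

-- A partially filled n × n array with integer entries: nothing = empty cell.
PArray : ℕ → Set
PArray n = Fin n → Fin n → Maybe ℤ

row : ∀ {n} → PArray n → Fin n → List ℤ
row {n} A i = mapMaybe id (map (λ j → A i j) (allFin n))

col : ∀ {n} → PArray n → Fin n → List ℤ
col {n} A j = mapMaybe id (map (λ i → A i j) (allFin n))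

partialSumsFrom : ℤ → List ℤ → List ℤ
partialSumsFrom s [] = []
partialSumsFrom s (a ∷ as) = (s ℤ.+ a) ∷ partialSumsFrom (s ℤ.+ a) as

partialSums : List ℤ → List ℤ
partialSums = partialSumsFrom (+ 0)

SimpleMod : (v : ℕ) .{{_ : NonZero v}} → List ℤ → Set
SimpleMod v as = Unique (map (λ s → s %ℕ v) (partialSums as))

record IsH (n k : ℕ) (A : PArray n) : Set where
  field
    entries : ∀ i j x → A i j ≡ just x → 1 ℕ.≤ ∣ x ∣ × ∣ x ∣ ℕ.≤ n ℕ.* k
    distinctAbs : ∀ i j i′ j′ x y → A i j ≡ just x → A i′ j′ ≡ just y →
                  ∣ x ∣ ≡ ∣ y ∣ → (i ≡ i′ × j ≡ j′)
    rowCount : ∀ i → length (row A i) ≡ k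
    colCount : ∀ j → length (col A j) ≡ k
    rowSum : ∀ i → sumℤ (row A i) ≡ + 0
    colSum : ∀ j → sumℤ (col A j) ≡ + 0

record IsSHstar (n k : ℕ) (A : PArray n) : Set where
  field
    isH : IsH n k A
    rowSimple₁ : ∀ i → SimpleMod (suc (2 ℕ.* n ℕ.* k)) (row A i)
    rowSimple₂ : ∀ i → SimpleMod (suc (suc (2 ℕ.* n ℕ.* k))) (row A i)
    colSimple₁ : ∀ j → SimpleMod (suc (2 ℕ.* n ℕ.* k)) (col A j)
    colSimple₂ : ∀ j → SimpleMod (suc (suc (2 ℕ.* n ℕ.* k))) (col A j)

-- Write n = r + 8a with r ∈ {0, 6, 10, 12}. The array is block diagonal: a base
-- block F_r, followed by a copies of one 8 × 8 block B₈, the t-th copy shifted so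
-- that its absolute values fill the window (6r + 48t, 6r + 48(t + 1)]. The windows
-- are disjoint, and every row or column of the array is a line of a single block.
-- Shifting by off sends x to x + sign(x)·off. Each line of B₈ has as many positive
-- as negative entries, so it still sums to 0, and a difference d of two of its
-- partial sums becomes d + e·off with e the difference of the sign counts. B₈ is
-- chosen with e ∈ {0, sign d} throughout, so these differences stay nonzero and
-- below 12n + 1 in absolute value: the partial sums remain distinct modulo 12n + 1
-- and 12n + 2. All conditions on F_r and B₈ are decided by evaluation.

module Submission where

open import Defs
open import Data.Nat using (ℕ; zero; suc; _≡ᵇ_; _+_; _*_; _≤_; _<_; _≤?_; _<?_; s≤s; NonZero)
import Data.Nat.Properties as ℕ
open import Data.Nat.Divisibility using (_∣_; divides; >⇒∤)
import Data.Nat.Tactic.RingSolver as ℕ-Ring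
open import Data.Integer as ℤ using (ℤ; +_; -[1+_]; ∣_∣; 0ℤ; 1ℤ; -1ℤ)
import Data.Integer.Properties as ℤ
import Data.Integer.Tactic.RingSolver as ℤ-Ring
open import Data.Integer.DivMod using (_%ℕ_; _/ℕ_; a≡a%ℕn+[a/ℕn]*n)
open import Data.Bool using (false)
open import Data.Fin using (Fin; _↑ˡ_; _↑ʳ_; splitAt)
import Data.Fin.Properties as Fin
open import Data.List using (List; []; _∷_; _++_; map; length; zip; tabulate; catMaybes; mapMaybe; allFin; cartesianProduct; findᵇ)
import Data.List.Properties as List
open import Data.List.Relation.Unary.AllPairs as AllPairs using (AllPairs; allPairs?)
import Data.List.Relation.Unary.AllPairs.Properties as AllPairs
open import Data.Maybe as Maybe using (Maybe; just; nothing; maybe)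
import Data.Maybe.Properties as Maybe
import Data.Maybe.Relation.Unary.All as MaybeAll
open import Data.Product using (Σ; _×_; _,_; proj₁; proj₂)
import Data.Product.Properties as Product
open import Data.Sum using (_⊎_; inj₁; inj₂)
open import Data.Vec as Vec using (Vec)
open import Function using (_∘_; id)
open import Relation.Binary using (Decidable)
open import Relation.Binary.PropositionalEquality
open import Relation.Nullary using (Dec; contradiction)
open import Relation.Nullary.Decidable using (_×-dec_; _⊎-dec_; from-yes)

open ≡-Reasoning

m∣n⇒n<m⇒n≡0 : ∀ {m n} → m ∣ n → n < m → n ≡ 0
m∣n⇒n<m⇒n≡0 {n = zero}  _   _   = refl
m∣n⇒n<m⇒n≡0 {n = suc _} m∣n n<m = contradiction m∣n (>⇒∤ n<m)

%ℕ-cong⇒∣i-j∣≡0 : ∀ v .{{_ : NonZero v}} x y →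
                  x %ℕ v ≡ y %ℕ v → ∣ x ℤ.- y ∣ < v → ∣ x ℤ.- y ∣ ≡ 0
%ℕ-cong⇒∣i-j∣≡0 v x y same-rem small = m∣n⇒n<m⇒n≡0 v∣x-y small
  where
  q : ℤ
  q = x /ℕ v ℤ.- y /ℕ v

  cancel : ∀ r a b c → (r ℤ.+ a ℤ.* c) ℤ.- (r ℤ.+ b ℤ.* c) ≡ (a ℤ.- b) ℤ.* c
  cancel = ℤ-Ring.solve-∀

  x-y≡q*v : x ℤ.- y ≡ q ℤ.* + v
  x-y≡q*v = begin
    x ℤ.- y
      ≡⟨ cong₂ ℤ._-_ (a≡a%ℕn+[a/ℕn]*n x v) (a≡a%ℕn+[a/ℕn]*n y v) ⟩
    (+ (x %ℕ v) ℤ.+ x /ℕ v ℤ.* + v) ℤ.- (+ (y %ℕ v) ℤ.+ y /ℕ v ℤ.* + v)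
      ≡⟨ cong (λ r → (+ (x %ℕ v) ℤ.+ x /ℕ v ℤ.* + v) ℤ.- (+ r ℤ.+ y /ℕ v ℤ.* + v)) (sym same-rem) ⟩
    (+ (x %ℕ v) ℤ.+ x /ℕ v ℤ.* + v) ℤ.- (+ (x %ℕ v) ℤ.+ y /ℕ v ℤ.* + v)
      ≡⟨ cancel (+ (x %ℕ v)) (x /ℕ v) (y /ℕ v) (+ v) ⟩
    q ℤ.* + v ∎

  v∣x-y : v ∣ ∣ x ℤ.- y ∣
  v∣x-y = divides ∣ q ∣ (trans (cong ∣_∣ x-y≡q*v) (ℤ.abs-* q (+ v)))

Near : ℕ → ℤ → ℤ → Set
Near K x y = 0 < ∣ x ℤ.- y ∣ × ∣ x ℤ.- y ∣ ≤ K

near? : ∀ K → Decidable (Near K)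
near? K x y = 0 <? ∣ x ℤ.- y ∣ ×-dec ∣ x ℤ.- y ∣ ≤? K

near⇒%ℕ-distinct : ∀ {K} v .{{_ : NonZero v}} → K < v →
                   ∀ {x y} → Near K x y → x %ℕ v ≢ y %ℕ v
near⇒%ℕ-distinct v K<v {x} {y} (0<∣x-y∣ , ∣x-y∣≤K) same-rem =
  ℕ.<-irrefl (sym (%ℕ-cong⇒∣i-j∣≡0 v x y same-rem (ℕ.≤-<-trans ∣x-y∣≤K K<v))) 0<∣x-y∣

near⇒simpleMod : ∀ {K} v .{{_ : NonZero v}} → K < v →
                 ∀ xs → AllPairs (Near K) (partialSums xs) → SimpleMod v xs
near⇒simpleMod v K<v xs near =
  AllPairs.map⁺ (AllPairs.map (λ {x} {y} → near⇒%ℕ-distinct v K<v {x} {y}) near)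

signum : ℤ → ℤ
signum (+ zero)  = 0ℤ
signum (+ suc _) = 1ℤ
signum -[1+ _ ]  = -1ℤ

weigh : ℕ → ℤ × ℤ → ℤ
weigh off (s , c) = s ℤ.+ c ℤ.* + off

weigh-+ : ∀ off s c s′ c′ →
          weigh off (s , c) ℤ.+ weigh off (s′ , c′) ≡ weigh off (s ℤ.+ s′ , c ℤ.+ c′)
weigh-+ off s c s′ c′ = regroup s c s′ c′ (+ off)
  where
  regroup : ∀ a b c d o → (a ℤ.+ b ℤ.* o) ℤ.+ (c ℤ.+ d ℤ.* o) ≡ (a ℤ.+ c) ℤ.+ (b ℤ.+ d) ℤ.* o
  regroup = ℤ-Ring.solve-∀

shift : ℕ → ℤ → ℤ
shift off x = weigh off (x , signum x)

∣shift∣ : ∀ off x → 0 < ∣ x ∣ → ∣ shift off x ∣ ≡ ∣ x ∣ + off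
∣shift∣ off (+ suc n)  _ = cong (λ t → ∣ + suc n ℤ.+ t ∣) (ℤ.*-identityˡ (+ off))
∣shift∣ off -[1+ n ] _ = begin
  ∣ -[1+ n ] ℤ.+ -1ℤ ℤ.* + off ∣    ≡⟨ cong (λ t → ∣ -[1+ n ] ℤ.+ t ∣) (ℤ.-1*i≡-i (+ off)) ⟩
  ∣ ℤ.- + suc n ℤ.+ ℤ.- + off ∣     ≡⟨ cong ∣_∣ (sym (ℤ.neg-distrib-+ (+ suc n) (+ off))) ⟩
  ∣ ℤ.- (+ (suc n + off)) ∣          ≡⟨ ℤ.∣-i∣≡∣i∣ (+ (suc n + off)) ⟩
  suc n + off                        ∎

sumℤ-map-shift : ∀ off xs → sumℤ (map (shift off) xs) ≡ weigh off (sumℤ xs , sumℤ (map signum xs))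
sumℤ-map-shift off []       = refl
sumℤ-map-shift off (x ∷ xs) = begin
  shift off x ℤ.+ sumℤ (map (shift off) xs)
    ≡⟨ cong (λ t → shift off x ℤ.+ t) (sumℤ-map-shift off xs) ⟩
  weigh off (x , signum x) ℤ.+ weigh off (sumℤ xs , sumℤ (map signum xs))
    ≡⟨ weigh-+ off x (signum x) (sumℤ xs) (sumℤ (map signum xs)) ⟩
  weigh off (x ℤ.+ sumℤ xs , signum x ℤ.+ sumℤ (map signum xs)) ∎

tally : List ℤ → List (ℤ × ℤ)
tally xs = zip (partialSums xs) (partialSums (map signum xs))

partialSumsFrom-map-shift : ∀ off s c xs →
  partialSumsFrom (weigh off (s , c)) (map (shift off) xs)
    ≡ map (weigh off) (zip (partialSumsFrom s xs) (partialSumsFrom c (map signum xs)))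
partialSumsFrom-map-shift off s c []       = refl
partialSumsFrom-map-shift off s c (x ∷ xs)
  rewrite weigh-+ off s c x (signum x) =
    cong (_ ∷_) (partialSumsFrom-map-shift off (s ℤ.+ x) (c ℤ.+ signum x) xs)

partialSums-map-shift : ∀ off xs → partialSums (map (shift off) xs) ≡ map (weigh off) (tally xs)
partialSums-map-shift off = partialSumsFrom-map-shift off 0ℤ 0ℤ

ShiftNear : ℕ → ℤ × ℤ → ℤ × ℤ → Set
ShiftNear K (s , c) (s′ , c′) = Near K s s′ × (c ℤ.- c′ ≡ 0ℤ ⊎ c ℤ.- c′ ≡ signum (s ℤ.- s′))

shiftNear? : ∀ K → Decidable (ShiftNear K)
shiftNear? K (s , c) (s′ , c′) =
  near? K s s′ ×-dec (c ℤ.- c′ ℤ.≟ 0ℤ ⊎-dec c ℤ.- c′ ℤ.≟ signum (s ℤ.- s′))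

near-shifted : ∀ {K} off {d e} → 0 < ∣ d ∣ → ∣ d ∣ ≤ K → e ≡ 0ℤ ⊎ e ≡ signum d →
               0 < ∣ d ℤ.+ e ℤ.* + off ∣ × ∣ d ℤ.+ e ℤ.* + off ∣ ≤ K + off
near-shifted {K} off {d} 0<∣d∣ ∣d∣≤K (inj₁ refl) =
  subst (λ t → 0 < t × t ≤ K + off) (sym (cong ∣_∣ (ℤ.+-identityʳ d)))
        (0<∣d∣ , ℕ.≤-trans ∣d∣≤K (ℕ.m≤m+n K off))
near-shifted {K} off {d} 0<∣d∣ ∣d∣≤K (inj₂ refl) =
  subst (λ t → 0 < t × t ≤ K + off) (sym (∣shift∣ off d 0<∣d∣))
        (ℕ.<-≤-trans 0<∣d∣ (ℕ.m≤m+n ∣ d ∣ off) , ℕ.+-monoˡ-≤ off ∣d∣≤K)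

shiftNear⇒near : ∀ {K} off {p q} → ShiftNear K p q → Near (K + off) (weigh off p) (weigh off q)
shiftNear⇒near {K} off {s , c} {s′ , c′} ((0<∣d∣ , ∣d∣≤K) , e) =
  subst (λ t → 0 < ∣ t ∣ × ∣ t ∣ ≤ K + off) (sym (difference (+ off) s c s′ c′))
        (near-shifted off 0<∣d∣ ∣d∣≤K e)
  where
  difference : ∀ o s c s′ c′ →
    (s ℤ.+ c ℤ.* o) ℤ.- (s′ ℤ.+ c′ ℤ.* o) ≡ (s ℤ.- s′) ℤ.+ (c ℤ.- c′) ℤ.* o
  difference = ℤ-Ring.solve-∀

record IsSHLine (n k : ℕ) (xs : List ℤ) : Set where
  field
    length≡k : length xs ≡ k
    sum≡0    : sumℤ xs ≡ 0ℤ
    simple₁  : SimpleMod (suc (2 * n * k)) xs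
    simple₂  : SimpleMod (suc (suc (2 * n * k))) xs

near⇒isSHLine : ∀ {n k K} xs → length xs ≡ k → sumℤ xs ≡ 0ℤ → K ≤ 2 * n * k →
                AllPairs (Near K) (partialSums xs) → IsSHLine n k xs
near⇒isSHLine xs len sum K≤2nk near = record
  { length≡k = len
  ; sum≡0    = sum
  ; simple₁  = near⇒simpleMod _ (s≤s K≤2nk) xs near
  ; simple₂  = near⇒simpleMod _ (s≤s (ℕ.m≤n⇒m≤1+n K≤2nk)) xs near
  }

BaseLine : ℕ → ℕ → List ℤ → Set
BaseLine k K xs = length xs ≡ k × sumℤ xs ≡ 0ℤ × AllPairs (Near K) (partialSums xs)

baseLine? : ∀ k K xs → Dec (BaseLine k K xs)
baseLine? k K xs =
  length xs ℕ.≟ k ×-dec sumℤ xs ℤ.≟ 0ℤ ×-dec allPairs? (near? K) (partialSums xs)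

baseLine⇒isSHLine : ∀ {n k K xs} → K ≤ 2 * n * k → BaseLine k K xs → IsSHLine n k xs
baseLine⇒isSHLine K≤2nk (len , sum , near) = near⇒isSHLine _ len sum K≤2nk near

ShiftableLine : ℕ → ℕ → List ℤ → Set
ShiftableLine k K xs =
  length xs ≡ k × sumℤ xs ≡ 0ℤ × sumℤ (map signum xs) ≡ 0ℤ × AllPairs (ShiftNear K) (tally xs)

shiftableLine? : ∀ k K xs → Dec (ShiftableLine k K xs)
shiftableLine? k K xs =
  length xs ℕ.≟ k ×-dec sumℤ xs ℤ.≟ 0ℤ ×-dec sumℤ (map signum xs) ℤ.≟ 0ℤ ×-dec
  allPairs? (shiftNear? K) (tally xs)

shiftableLine⇒isSHLine : ∀ {n k K xs} off → K + off ≤ 2 * n * k → ShiftableLine k K xs →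
                         IsSHLine n k (map (shift off) xs)
shiftableLine⇒isSHLine {xs = xs} off bound (len , sum , signs , near) =
  near⇒isSHLine _ (trans (List.length-map (shift off) xs) len) shifted-sum bound shifted-near
  where
  shifted-sum : sumℤ (map (shift off) xs) ≡ 0ℤ
  shifted-sum = trans (sumℤ-map-shift off xs) (cong₂ (λ s c → weigh off (s , c)) sum signs)

  shifted-near : AllPairs (Near _) (partialSums (map (shift off) xs))
  shifted-near rewrite partialSums-map-shift off xs =
    AllPairs.map⁺ (AllPairs.map (λ {p} {q} → shiftNear⇒near off {p} {q}) near)

filled : ∀ {m} → (Fin m → Maybe ℤ) → List ℤ
filled {m} f = mapMaybe id (map f (allFin m))

filled≡catMaybes∘tabulate : ∀ {m} (f : Fin m → Maybe ℤ) → filled f ≡ catMaybes (tabulate f)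
filled≡catMaybes∘tabulate {m} f =
  trans (List.mapMaybe-map id f (allFin m)) (cong catMaybes (List.map-tabulate id f))

filled-map : ∀ {m} (h : ℤ → ℤ) (f : Fin m → Maybe ℤ) → filled (Maybe.map h ∘ f) ≡ map h (filled f)
filled-map h f = begin
  filled (Maybe.map h ∘ f)                   ≡⟨ filled≡catMaybes∘tabulate (Maybe.map h ∘ f) ⟩
  catMaybes (tabulate (Maybe.map h ∘ f))     ≡⟨ cong catMaybes (List.map-tabulate f (Maybe.map h)) ⟨
  catMaybes (map (Maybe.map h) (tabulate f)) ≡⟨ List.map-catMaybes h (tabulate f) ⟨
  map h (catMaybes (tabulate f))             ≡⟨ cong (map h) (filled≡catMaybes∘tabulate f) ⟨
  map h (filled f)                           ∎

tabulate-↑ : ∀ {A : Set} p {q} (f : Fin (p + q) → A) →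
             tabulate f ≡ tabulate (f ∘ (_↑ˡ q)) ++ tabulate (f ∘ (p ↑ʳ_))
tabulate-↑ zero    f = refl
tabulate-↑ (suc p) f = cong (f Fin.zero ∷_) (tabulate-↑ p (f ∘ Fin.suc))

filled-↑ : ∀ p {q} (f : Fin (p + q) → Maybe ℤ) →
           filled f ≡ filled (f ∘ (_↑ˡ q)) ++ filled (f ∘ (p ↑ʳ_))
filled-↑ p {q} f = begin
  filled f                                                      ≡⟨ filled≡catMaybes∘tabulate f ⟩
  catMaybes (tabulate f)                                        ≡⟨ cong catMaybes (tabulate-↑ p f) ⟩
  catMaybes (tabulate (f ∘ (_↑ˡ q)) ++ tabulate (f ∘ (p ↑ʳ_)))
    ≡⟨ List.catMaybes-++ (tabulate (f ∘ (_↑ˡ q))) _ ⟩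
  catMaybes (tabulate (f ∘ (_↑ˡ q))) ++ catMaybes (tabulate (f ∘ (p ↑ʳ_)))
    ≡⟨ cong₂ _++_ (filled≡catMaybes∘tabulate (f ∘ (_↑ˡ q)))
                  (filled≡catMaybes∘tabulate (f ∘ (p ↑ʳ_))) ⟨
  filled (f ∘ (_↑ˡ q)) ++ filled (f ∘ (p ↑ʳ_))                 ∎

filled-cong : ∀ {m} {f g : Fin m → Maybe ℤ} → (∀ i → f i ≡ g i) → filled f ≡ filled g
filled-cong {m} f≗g = cong (mapMaybe id) (List.map-cong f≗g (allFin m))

filled-nothing : ∀ {m} {f : Fin m → Maybe ℤ} → (∀ i → f i ≡ nothing) → filled f ≡ []
filled-nothing {m} {f} f≗nothing = begin
  filled f                                     ≡⟨ filled-cong f≗nothing ⟩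
  mapMaybe id (map (λ _ → nothing) (allFin m)) ≡⟨ List.mapMaybe-map id (λ _ → nothing) (allFin m) ⟩
  mapMaybe (λ _ → nothing) (allFin m)          ≡⟨ List.mapMaybe-nothing (allFin m) ⟩
  []                                           ∎

shiftArray : ∀ {m} → ℕ → PArray m → PArray m
shiftArray off B i j = Maybe.map (shift off) (B i j)

row-shiftArray : ∀ {m} off (B : PArray m) i → row (shiftArray off B) i ≡ map (shift off) (row B i)
row-shiftArray off B i = filled-map (shift off) (B i)

col-shiftArray : ∀ {m} off (B : PArray m) j → col (shiftArray off B) j ≡ map (shift off) (col B j)
col-shiftArray off B j = filled-map (shift off) (λ i → B i j)

diagonal : ∀ {p q} → PArray p → PArray q → Fin p ⊎ Fin q → Fin p ⊎ Fin q → Maybe ℤ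
diagonal A B (inj₁ a) (inj₁ b) = A a b
diagonal A B (inj₂ a) (inj₂ b) = B a b
diagonal A B _        _        = nothing

_⊕_ : ∀ {p q} → PArray p → PArray q → PArray (p + q)
_⊕_ {p} A B i j = diagonal A B (splitAt p i) (splitAt p j)

data Side (p q : ℕ) : Fin (p + q) → Set where
  left  : ∀ a → Side p q (a ↑ˡ q)
  right : ∀ b → Side p q (p ↑ʳ b)

side : ∀ p q i → Side p q i
side p q i with splitAt p i in eq
... | inj₁ a = subst (Side p q) (Fin.splitAt⁻¹-↑ˡ eq) (left a)
... | inj₂ b = subst (Side p q) (Fin.splitAt⁻¹-↑ʳ eq) (right b)

module _ {p q} (A : PArray p) (B : PArray q) where

  ⊕-ll : ∀ a a′ → (A ⊕ B) (a ↑ˡ q) (a′ ↑ˡ q) ≡ A a a′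
  ⊕-ll a a′ rewrite Fin.splitAt-↑ˡ p a q | Fin.splitAt-↑ˡ p a′ q = refl

  ⊕-lr : ∀ a b → (A ⊕ B) (a ↑ˡ q) (p ↑ʳ b) ≡ nothing
  ⊕-lr a b rewrite Fin.splitAt-↑ˡ p a q | Fin.splitAt-↑ʳ p q b = refl

  ⊕-rl : ∀ b a → (A ⊕ B) (p ↑ʳ b) (a ↑ˡ q) ≡ nothing
  ⊕-rl b a rewrite Fin.splitAt-↑ʳ p q b | Fin.splitAt-↑ˡ p a q = refl

  ⊕-rr : ∀ b b′ → (A ⊕ B) (p ↑ʳ b) (p ↑ʳ b′) ≡ B b b′
  ⊕-rr b b′ rewrite Fin.splitAt-↑ʳ p q b | Fin.splitAt-↑ʳ p q b′ = refl

  row-⊕ˡ : ∀ a → row (A ⊕ B) (a ↑ˡ q) ≡ row A a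
  row-⊕ˡ a = trans (filled-↑ p _)
    (trans (cong₂ _++_ (filled-cong (⊕-ll a)) (filled-nothing (⊕-lr a))) (List.++-identityʳ _))

  row-⊕ʳ : ∀ b → row (A ⊕ B) (p ↑ʳ b) ≡ row B b
  row-⊕ʳ b = trans (filled-↑ p _)
    (cong₂ _++_ (filled-nothing (⊕-rl b)) (filled-cong (⊕-rr b)))

  col-⊕ˡ : ∀ a → col (A ⊕ B) (a ↑ˡ q) ≡ col A a
  col-⊕ˡ a = trans (filled-↑ p _)
    (trans (cong₂ _++_ (filled-cong (λ a′ → ⊕-ll a′ a)) (filled-nothing (λ b → ⊕-rl b a)))
           (List.++-identityʳ _))

  col-⊕ʳ : ∀ b → col (A ⊕ B) (p ↑ʳ b) ≡ col B b
  col-⊕ʳ b = trans (filled-↑ p _)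
    (cong₂ _++_ (filled-nothing (λ a → ⊕-lr a b)) (filled-cong (λ b′ → ⊕-rr b′ b)))

  data Cell⊕ (i j : Fin (p + q)) (x : ℤ) : Set where
    inˡ : ∀ a a′ → i ≡ a ↑ˡ q → j ≡ a′ ↑ˡ q → A a a′ ≡ just x → Cell⊕ i j x
    inʳ : ∀ b b′ → i ≡ p ↑ʳ b → j ≡ p ↑ʳ b′ → B b b′ ≡ just x → Cell⊕ i j x

  cell⊕ : ∀ i j {x} → (A ⊕ B) i j ≡ just x → Cell⊕ i j x
  cell⊕ i j A⊕Bij≡x with side p q i | side p q j
  ... | left a  | left a′  = inˡ a a′ refl refl (trans (sym (⊕-ll a a′)) A⊕Bij≡x)
  ... | left a  | right b  = contradiction (trans (sym (⊕-lr a b)) A⊕Bij≡x) λ ()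
  ... | right b | left a   = contradiction (trans (sym (⊕-rl b a)) A⊕Bij≡x) λ ()
  ... | right b | right b′ = inʳ b b′ refl refl (trans (sym (⊕-rr b b′)) A⊕Bij≡x)

record IsSHBlock (n k lo : ℕ) {m} (A : PArray m) : Set where
  field
    bounds      : ∀ i j x → A i j ≡ just x → lo < ∣ x ∣ × ∣ x ∣ ≤ lo + m * k
    distinctAbs : ∀ i j i′ j′ x y → A i j ≡ just x → A i′ j′ ≡ just y →
                  ∣ x ∣ ≡ ∣ y ∣ → (i ≡ i′ × j ≡ j′)
    rowLine     : ∀ i → IsSHLine n k (row A i)
    colLine     : ∀ j → IsSHLine n k (col A j)

isSHBlock⇒isSHstar : ∀ {n k} {A : PArray n} → IsSHBlock n k 0 A → IsSHstar n k A
isSHBlock⇒isSHstar block = record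
  { isH = record
    { entries     = bounds
    ; distinctAbs = distinctAbs
    ; rowCount    = IsSHLine.length≡k ∘ rowLine
    ; colCount    = IsSHLine.length≡k ∘ colLine
    ; rowSum      = IsSHLine.sum≡0 ∘ rowLine
    ; colSum      = IsSHLine.sum≡0 ∘ colLine
    }
  ; rowSimple₁ = IsSHLine.simple₁ ∘ rowLine
  ; rowSimple₂ = IsSHLine.simple₂ ∘ rowLine
  ; colSimple₁ = IsSHLine.simple₁ ∘ colLine
  ; colSimple₂ = IsSHLine.simple₂ ∘ colLine
  }
  where open IsSHBlock block

emptyArray : PArray 0
emptyArray ()

emptyArray-isSHBlock : ∀ {n k lo} → IsSHBlock n k lo emptyArray
emptyArray-isSHBlock =
  record { bounds = λ () ; distinctAbs = λ () ; rowLine = λ () ; colLine = λ () }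

⊕-isSHBlock : ∀ {n k lo p q} {A : PArray p} {B : PArray q} →
              IsSHBlock n k lo A → IsSHBlock n k (lo + p * k) B → IsSHBlock n k lo (A ⊕ B)
⊕-isSHBlock {n} {k} {lo} {p} {q} {A} {B} blockA blockB = record
  { bounds = bounds ; distinctAbs = distinctAbs ; rowLine = rowLine ; colLine = colLine }
  where
  module A = IsSHBlock blockA
  module B = IsSHBlock blockB

  windows : lo + p * k + q * k ≡ lo + (p + q) * k
  windows = trans (ℕ.+-assoc lo (p * k) (q * k))
                  (cong (λ t → lo + t) (sym (ℕ.*-distribʳ-+ k p q)))

  bounds : ∀ i j x → (A ⊕ B) i j ≡ just x → lo < ∣ x ∣ × ∣ x ∣ ≤ lo + (p + q) * k
  bounds i j x e with cell⊕ A B i j e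
  ... | inˡ a a′ _ _ e′ =
    proj₁ (A.bounds a a′ x e′) ,
    ℕ.≤-trans (proj₂ (A.bounds a a′ x e′)) (ℕ.+-monoʳ-≤ lo (ℕ.*-monoˡ-≤ k (ℕ.m≤m+n p q)))
  ... | inʳ b b′ _ _ e′ =
    ℕ.≤-<-trans (ℕ.m≤m+n lo (p * k)) (proj₁ (B.bounds b b′ x e′)) ,
    subst (∣ x ∣ ≤_) windows (proj₂ (B.bounds b b′ x e′))

  distinctAbs : ∀ i j i′ j′ x y → (A ⊕ B) i j ≡ just x → (A ⊕ B) i′ j′ ≡ just y →
                ∣ x ∣ ≡ ∣ y ∣ → (i ≡ i′ × j ≡ j′)
  distinctAbs i j i′ j′ x y ex ey ∣x∣≡∣y∣ with cell⊕ A B i j ex | cell⊕ A B i′ j′ ey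
  ... | inˡ a a′ refl refl ex′ | inˡ c c′ refl refl ey′ =
    let a≡c , a′≡c′ = A.distinctAbs a a′ c c′ x y ex′ ey′ ∣x∣≡∣y∣
    in cong (_↑ˡ q) a≡c , cong (_↑ˡ q) a′≡c′
  ... | inʳ b b′ refl refl ex′ | inʳ c c′ refl refl ey′ =
    let b≡c , b′≡c′ = B.distinctAbs b b′ c c′ x y ex′ ey′ ∣x∣≡∣y∣
    in cong (p ↑ʳ_) b≡c , cong (p ↑ʳ_) b′≡c′
  ... | inˡ a a′ _ _ ex′ | inʳ c c′ _ _ ey′ = contradiction ∣x∣≡∣y∣
    (ℕ.<⇒≢ (ℕ.≤-<-trans (proj₂ (A.bounds a a′ x ex′)) (proj₁ (B.bounds c c′ y ey′))))
  ... | inʳ b b′ _ _ ex′ | inˡ c c′ _ _ ey′ = contradiction (sym ∣x∣≡∣y∣)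
    (ℕ.<⇒≢ (ℕ.≤-<-trans (proj₂ (A.bounds c c′ y ey′)) (proj₁ (B.bounds b b′ x ex′))))

  rowLine : ∀ i → IsSHLine n k (row (A ⊕ B) i)
  rowLine i with side p q i
  ... | left a  = subst (IsSHLine n k) (sym (row-⊕ˡ A B a)) (A.rowLine a)
  ... | right b = subst (IsSHLine n k) (sym (row-⊕ʳ A B b)) (B.rowLine b)

  colLine : ∀ j → IsSHLine n k (col (A ⊕ B) j)
  colLine j with side p q j
  ... | left a  = subst (IsSHLine n k) (sym (col-⊕ˡ A B a)) (A.colLine a)
  ... | right b = subst (IsSHLine n k) (sym (col-⊕ʳ A B b)) (B.colLine b)

locate : ∀ {m} → PArray m → ℕ → Maybe (Fin m × Fin m)
locate {m} B v =
  findᵇ (λ (i , j) → maybe (λ x → ∣ x ∣ ≡ᵇ v) false (B i j))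
        (cartesianProduct (allFin m) (allFin m))

-- Any map from absolute values to cells would do in place of locate: checking that
-- it sends the absolute value of each entry back to that entry's cell proves the
-- absolute values pairwise distinct.
CellCertificate : ∀ {m} → ℕ → PArray m → Fin m → Fin m → Set
CellCertificate {m} k B i j =
  MaybeAll.All (λ x → 0 < ∣ x ∣ × ∣ x ∣ ≤ m * k × locate B ∣ x ∣ ≡ just (i , j)) (B i j)

cellCertificate? : ∀ {m} k (B : PArray m) i j → Dec (CellCertificate k B i j)
cellCertificate? {m} k B i j =
  MaybeAll.dec (λ x → 0 <? ∣ x ∣ ×-dec ∣ x ∣ ≤? m * k ×-dec locate B ∣ x ∣ ≟ just (i , j)) (B i j)
  where _≟_ = Maybe.≡-dec (Product.≡-dec Fin._≟_ Fin._≟_)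

Certificate : ∀ {m} → (List ℤ → Set) → ℕ → PArray m → Set
Certificate Line k B =
  (∀ i j → CellCertificate k B i j) × (∀ i → Line (row B i)) × (∀ j → Line (col B j))

certificate? : ∀ {m} {Line : List ℤ → Set} → (∀ xs → Dec (Line xs)) →
               ∀ k (B : PArray m) → Dec (Certificate Line k B)
certificate? line? k B =
  Fin.all? (λ i → Fin.all? (cellCertificate? k B i)) ×-dec
  Fin.all? (line? ∘ row B) ×-dec
  Fin.all? (line? ∘ col B)

BaseCertificate ShiftCertificate : ∀ {m} → ℕ → PArray m → Set
BaseCertificate  {m} k = Certificate (BaseLine k (2 * m * k)) k
ShiftCertificate {m} k = Certificate (ShiftableLine k (2 * m * k)) k

baseCertificate? : ∀ {m} k (B : PArray m) → Dec (BaseCertificate k B)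
baseCertificate? {m} k = certificate? (baseLine? k (2 * m * k)) k

shiftCertificate? : ∀ {m} k (B : PArray m) → Dec (ShiftCertificate k B)
shiftCertificate? {m} k = certificate? (shiftableLine? k (2 * m * k)) k

module _ {m k} {B : PArray m} (cells : ∀ i j → CellCertificate k B i j) where

  certified-entry : ∀ {i j x} → B i j ≡ just x →
                    0 < ∣ x ∣ × ∣ x ∣ ≤ m * k × locate B ∣ x ∣ ≡ just (i , j)
  certified-entry {i} {j} e = MaybeAll.drop-just (subst (MaybeAll.All _) e (cells i j))

  certified-distinctAbs : ∀ i j i′ j′ x y → B i j ≡ just x → B i′ j′ ≡ just y →
                          ∣ x ∣ ≡ ∣ y ∣ → (i ≡ i′ × j ≡ j′)
  certified-distinctAbs i j i′ j′ x y ex ey ∣x∣≡∣y∣ =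
    Product.,-injectiveˡ same-cell , Product.,-injectiveʳ same-cell
    where
    same-cell : (i , j) ≡ (i′ , j′)
    same-cell = Maybe.just-injective (begin
      just (i , j)     ≡⟨ proj₂ (proj₂ (certified-entry ex)) ⟨
      locate B ∣ x ∣   ≡⟨ cong (locate B) ∣x∣≡∣y∣ ⟩
      locate B ∣ y ∣   ≡⟨ proj₂ (proj₂ (certified-entry ey)) ⟩
      just (i′ , j′)   ∎)

base-isSHBlock : ∀ {n k m} {B : PArray m} → m ≤ n → BaseCertificate k B → IsSHBlock n k 0 B
base-isSHBlock {n} {k} {m} m≤n (cells , rows , cols) = record
  { bounds      = λ i j x e →
      proj₁ (certified-entry cells e) , proj₁ (proj₂ (certified-entry cells e))
  ; distinctAbs = certified-distinctAbs cells
  ; rowLine     = baseLine⇒isSHLine 2mk≤2nk ∘ rows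
  ; colLine     = baseLine⇒isSHLine 2mk≤2nk ∘ cols
  }
  where
  2mk≤2nk : 2 * m * k ≤ 2 * n * k
  2mk≤2nk = ℕ.*-monoˡ-≤ k (ℕ.*-monoʳ-≤ 2 m≤n)

shiftArray-just : ∀ {m} off {B : PArray m} {i j y} → shiftArray off B i j ≡ just y →
                  Σ ℤ λ x → B i j ≡ just x × shift off x ≡ y
shiftArray-just off {B} {i} {j} e with B i j
shiftArray-just off e | just x = x , refl , Maybe.just-injective e

shift-isSHBlock : ∀ {n k m} {B : PArray m} off → off + m * k ≤ n * k → ShiftCertificate k B →
                  IsSHBlock n k off (shiftArray off B)
shift-isSHBlock {n} {k} {m} {B} off fits (cells , rows , cols) = record
  { bounds = bounds ; distinctAbs = distinctAbs ; rowLine = rowLine ; colLine = colLine }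
  where
  ∣shifted∣ : ∀ {i j x} → B i j ≡ just x → ∣ shift off x ∣ ≡ ∣ x ∣ + off
  ∣shifted∣ {x = x} e = ∣shift∣ off x (proj₁ (certified-entry cells e))

  bounds : ∀ i j y → shiftArray off B i j ≡ just y → off < ∣ y ∣ × ∣ y ∣ ≤ off + m * k
  bounds i j y e with shiftArray-just off {B} {i} {j} e
  ... | x , ex , refl with certified-entry cells ex
  ...   | 0<∣x∣ , ∣x∣≤mk , _ = subst (λ t → off < t × t ≤ off + m * k) (sym (∣shifted∣ ex))
    (ℕ.+-monoˡ-< off 0<∣x∣ , subst (∣ x ∣ + off ≤_) (ℕ.+-comm (m * k) off) (ℕ.+-monoˡ-≤ off ∣x∣≤mk))

  distinctAbs : ∀ i j i′ j′ x y → shiftArray off B i j ≡ just x →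
                shiftArray off B i′ j′ ≡ just y → ∣ x ∣ ≡ ∣ y ∣ → (i ≡ i′ × j ≡ j′)
  distinctAbs i j i′ j′ _ _ ex ey ∣x∣≡∣y∣
    with shiftArray-just off {B} {i} {j} ex | shiftArray-just off {B} {i′} {j′} ey
  ... | x , ex′ , refl | y , ey′ , refl =
    certified-distinctAbs cells i j i′ j′ x y ex′ ey′
      (ℕ.+-cancelʳ-≡ off ∣ x ∣ ∣ y ∣ (trans (sym (∣shifted∣ ex′)) (trans ∣x∣≡∣y∣ (∣shifted∣ ey′))))

  fits-twice : 2 * m * k + off ≤ 2 * n * k
  fits-twice = subst₂ _≤_ (sym (regroup m k off)) (sym (double n k))
    (ℕ.+-mono-≤ (ℕ.≤-trans (ℕ.m≤n+m (m * k) off) fits) fits)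
    where
    regroup : ∀ m k off → 2 * m * k + off ≡ m * k + (off + m * k)
    regroup = ℕ-Ring.solve-∀
    double : ∀ n k → 2 * n * k ≡ n * k + n * k
    double = ℕ-Ring.solve-∀

  rowLine : ∀ i → IsSHLine n k (row (shiftArray off B) i)
  rowLine i = subst (IsSHLine n k) (sym (row-shiftArray off B i))
                    (shiftableLine⇒isSHLine off fits-twice (rows i))

  colLine : ∀ j → IsSHLine n k (col (shiftArray off B) j)
  colLine j = subst (IsSHLine n k) (sym (col-shiftArray off B j))
                    (shiftableLine⇒isSHLine off fits-twice (cols j))

tile : ∀ {m} → ℕ → PArray m → ∀ a → ℕ → PArray (a * m)
tile     k B zero    off = emptyArray
tile {m} k B (suc a) off = shiftArray off B ⊕ tile k B a (off + m * k)

tile-isSHBlock : ∀ {n k m} {B : PArray m} → ShiftCertificate k B →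
                 ∀ a off → off + a * m * k ≤ n * k → IsSHBlock n k off (tile k B a off)
tile-isSHBlock certificate zero    off _    = emptyArray-isSHBlock
tile-isSHBlock {n} {k} {m} certificate (suc a) off fits =
  ⊕-isSHBlock (shift-isSHBlock off first-fits certificate)
              (tile-isSHBlock certificate a (off + m * k) rest-fits)
  where
  regroup : ∀ off m a k → off + (m + a * m) * k ≡ off + m * k + a * m * k
  regroup = ℕ-Ring.solve-∀

  rest-fits : off + m * k + a * m * k ≤ n * k
  rest-fits = subst (_≤ n * k) (regroup off m a k) fits

  first-fits : off + m * k ≤ n * k
  first-fits = ℕ.≤-trans (ℕ.m≤m+n (off + m * k) (a * m * k)) rest-fits

base⊕tile-isSHstar : ∀ {r m k} {F : PArray r} {B : PArray m} →
                     BaseCertificate k F → ShiftCertificate k B →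
                     ∀ a → IsSHstar (r + a * m) k (F ⊕ tile k B a (r * k))
base⊕tile-isSHstar {r} {m} {k} baseCertificate shiftCertificate a =
  isSHBlock⇒isSHstar (⊕-isSHBlock (base-isSHBlock (ℕ.m≤m+n r (a * m)) baseCertificate)
                                  (tile-isSHBlock shiftCertificate a (r * k) tiles-fit))
  where
  tiles-fit : r * k + a * m * k ≤ (r + a * m) * k
  tiles-fit = ℕ.≤-reflexive (sym (ℕ.*-distribʳ-+ k r (a * m)))

-- Tables list entries row by row, with 0 marking an empty cell.
fromTable : ∀ {m} → Vec (Vec ℤ m) m → PArray m
fromTable table i j = nonzero (Vec.lookup (Vec.lookup table i) j)
  where
  nonzero : ℤ → Maybe ℤ
  nonzero (+ zero) = nothing
  nonzero x        = just x

module Tables where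

  open import Agda.Builtin.FromNat using (Number; fromNat)
  open import Agda.Builtin.FromNeg using (Negative)
  open import Data.Unit using (tt)
  import Data.Nat.Literals as ℕLiterals
  import Data.Integer.Literals as ℤLiterals
  open import Data.Vec using (_∷_; [])

  instance
    ℕ-number : Number ℕ
    ℕ-number = ℕLiterals.number
    ℤ-number : Number ℤ
    ℤ-number = ℤLiterals.number
    ℤ-negative : Negative ℤ
    ℤ-negative = ℤLiterals.negative

  F₆ : PArray 6
  F₆ = fromTable (
    ( -29 ∷  -5 ∷  16 ∷  11 ∷  13 ∷  -6 ∷ [] ) ∷
    (  18 ∷   1 ∷  -7 ∷ -22 ∷  25 ∷ -15 ∷ [] ) ∷
    (   2 ∷ -33 ∷  23 ∷ -21 ∷   3 ∷  26 ∷ [] ) ∷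
    (  12 ∷  31 ∷ -24 ∷  19 ∷ -34 ∷  -4 ∷ [] ) ∷
    ( -35 ∷  14 ∷  28 ∷  30 ∷ -27 ∷ -10 ∷ [] ) ∷
    (  32 ∷  -8 ∷ -36 ∷ -17 ∷  20 ∷   9 ∷ [] ) ∷
    [] )

  F₁₀ : PArray 10
  F₁₀ = fromTable (
    (   2 ∷  44 ∷   8 ∷ -29 ∷ -31 ∷   6 ∷   0 ∷   0 ∷   0 ∷   0 ∷ [] ) ∷
    (   0 ∷ -41 ∷ -28 ∷  38 ∷   7 ∷ -27 ∷  51 ∷   0 ∷   0 ∷   0 ∷ [] ) ∷
    (   0 ∷   0 ∷  56 ∷ -36 ∷  30 ∷  26 ∷ -43 ∷ -33 ∷   0 ∷   0 ∷ [] ) ∷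
    (   0 ∷   0 ∷   0 ∷ -37 ∷  50 ∷ -55 ∷  35 ∷  49 ∷ -42 ∷   0 ∷ [] ) ∷
    (   0 ∷   0 ∷   0 ∷   0 ∷  -9 ∷ -10 ∷ -14 ∷ -21 ∷  57 ∷  -3 ∷ [] ) ∷
    ( -22 ∷   0 ∷   0 ∷   0 ∷   0 ∷  60 ∷ -40 ∷  34 ∷  16 ∷ -48 ∷ [] ) ∷
    (   1 ∷  39 ∷   0 ∷   0 ∷   0 ∷   0 ∷  11 ∷ -46 ∷ -25 ∷  20 ∷ [] ) ∷
    (  58 ∷ -23 ∷  12 ∷   0 ∷   0 ∷   0 ∷   0 ∷  17 ∷ -59 ∷  -5 ∷ [] ) ∷
    ( -15 ∷  13 ∷ -52 ∷  19 ∷   0 ∷   0 ∷   0 ∷   0 ∷  53 ∷ -18 ∷ [] ) ∷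
    ( -24 ∷ -32 ∷   4 ∷  45 ∷ -47 ∷   0 ∷   0 ∷   0 ∷   0 ∷  54 ∷ [] ) ∷
    [] )

  F₁₂ : PArray 12
  F₁₂ = fromTable (
    ( -52 ∷  46 ∷  65 ∷ -35 ∷  12 ∷ -36 ∷   0 ∷   0 ∷   0 ∷   0 ∷   0 ∷   0 ∷ [] ) ∷
    (   0 ∷ -59 ∷ -21 ∷  56 ∷  38 ∷  19 ∷ -33 ∷   0 ∷   0 ∷   0 ∷   0 ∷   0 ∷ [] ) ∷
    (   0 ∷   0 ∷ -55 ∷ -16 ∷ -54 ∷  28 ∷  44 ∷  53 ∷   0 ∷   0 ∷   0 ∷   0 ∷ [] ) ∷
    (   0 ∷   0 ∷   0 ∷  61 ∷  13 ∷ -48 ∷ -14 ∷ -34 ∷  22 ∷   0 ∷   0 ∷   0 ∷ [] ) ∷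
    (   0 ∷   0 ∷   0 ∷   0 ∷ -71 ∷  40 ∷ -41 ∷  -9 ∷  49 ∷  32 ∷   0 ∷   0 ∷ [] ) ∷
    (   0 ∷   0 ∷   0 ∷   0 ∷   0 ∷  -3 ∷  26 ∷   8 ∷ -37 ∷   4 ∷   2 ∷   0 ∷ [] ) ∷
    (   0 ∷   0 ∷   0 ∷   0 ∷   0 ∷   0 ∷  18 ∷  45 ∷  43 ∷ -47 ∷ -60 ∷   1 ∷ [] ) ∷
    (  10 ∷   0 ∷   0 ∷   0 ∷   0 ∷   0 ∷   0 ∷ -63 ∷ -70 ∷  29 ∷  67 ∷  27 ∷ [] ) ∷
    ( -66 ∷ -58 ∷   0 ∷   0 ∷   0 ∷   0 ∷   0 ∷   0 ∷  -7 ∷  39 ∷  68 ∷  24 ∷ [] ) ∷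
    (  69 ∷  17 ∷   6 ∷   0 ∷   0 ∷   0 ∷   0 ∷   0 ∷   0 ∷ -57 ∷  -5 ∷ -30 ∷ [] ) ∷
    ( -11 ∷  31 ∷  25 ∷ -15 ∷   0 ∷   0 ∷   0 ∷   0 ∷   0 ∷   0 ∷ -72 ∷  42 ∷ [] ) ∷
    (  50 ∷  23 ∷ -20 ∷ -51 ∷  62 ∷   0 ∷   0 ∷   0 ∷   0 ∷   0 ∷   0 ∷ -64 ∷ [] ) ∷
    [] )

  B₈ : PArray 8
  B₈ = fromTable (
    (  41 ∷ -39 ∷  29 ∷ -26 ∷   4 ∷  -9 ∷   0 ∷   0 ∷ [] ) ∷
    (   0 ∷  11 ∷ -21 ∷  34 ∷ -18 ∷   1 ∷  -7 ∷   0 ∷ [] ) ∷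
    (   0 ∷   0 ∷  30 ∷ -14 ∷  19 ∷  -8 ∷  13 ∷ -40 ∷ [] ) ∷
    ( -43 ∷   0 ∷   0 ∷   3 ∷ -10 ∷  15 ∷ -12 ∷  47 ∷ [] ) ∷
    (  16 ∷  -6 ∷   0 ∷   0 ∷  28 ∷ -31 ∷  20 ∷ -27 ∷ [] ) ∷
    ( -17 ∷  36 ∷ -46 ∷   0 ∷   0 ∷  32 ∷ -38 ∷  33 ∷ [] ) ∷
    (  25 ∷ -44 ∷  45 ∷  -2 ∷   0 ∷   0 ∷  24 ∷ -48 ∷ [] ) ∷
    ( -22 ∷  42 ∷ -37 ∷   5 ∷ -23 ∷   0 ∷   0 ∷  35 ∷ [] ) ∷
    [] )

open Tables using (F₆; F₁₀; F₁₂; B₈)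

F₆-certificate : BaseCertificate 6 F₆
F₆-certificate = from-yes (baseCertificate? 6 F₆)

F₁₀-certificate : BaseCertificate 6 F₁₀
F₁₀-certificate = from-yes (baseCertificate? 6 F₁₀)

F₁₂-certificate : BaseCertificate 6 F₁₂
F₁₂-certificate = from-yes (baseCertificate? 6 F₁₂)

emptyArray-certificate : BaseCertificate 6 emptyArray
emptyArray-certificate = from-yes (baseCertificate? 6 emptyArray)

B₈-certificate : ShiftCertificate 6 B₈
B₈-certificate = from-yes (shiftCertificate? 6 B₈)

data Decomposition : ℕ → Set where
  base⊕8× : ∀ {r} (F : PArray r) → BaseCertificate 6 F → ∀ a → Decomposition (r + a * 8)

decompose : ∀ q → 6 ≤ q * 2 → Decomposition (q * 2)
decompose 1 (s≤s (s≤s ()))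
decompose 2 (s≤s (s≤s (s≤s (s≤s ()))))
decompose 3 _ = base⊕8× F₆ F₆-certificate 0
decompose 4 _ = base⊕8× emptyArray emptyArray-certificate 1
decompose 5 _ = base⊕8× F₁₀ F₁₀-certificate 0
decompose 6 _ = base⊕8× F₁₂ F₁₂-certificate 0
decompose (suc (suc (suc (suc q@(suc (suc (suc q′))))))) _ =
  eight+ (decompose q (ℕ.m≤m+n 6 (q′ * 2)))
  where
  eight+ : ∀ {n} → Decomposition n → Decomposition (8 + n)
  eight+ (base⊕8× {r} F certificate a) =
    subst Decomposition (shuffle r a) (base⊕8× F certificate (suc a))
    where
    shuffle : ∀ r a → r + (8 + a * 8) ≡ 8 + (r + a * 8)
    shuffle = ℕ-Ring.solve-∀

decomposition⇒SHstar : ∀ {n} → Decomposition n → Σ (PArray n) (IsSHstar n 6)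
decomposition⇒SHstar (base⊕8× {r} F certificate a) =
  F ⊕ tile 6 B₈ a (r * 6) , base⊕tile-isSHstar certificate B₈-certificate a

proposition4p1 : (n : ℕ) → 6 ≤ n → 2 ∣ n → Σ (PArray n) (IsSHstar n 6)
proposition4p1 n 6≤n (divides q refl) = decomposition⇒SHstar (decompose q 6≤n)
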